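{- Let $m \ge 1$ and $p \ge 2m+3$ be integers, and let $\bar x = x_0x_1\ldots x_{m-1}$ be an $m$-bit string. Define, for $i=0,\dots,m$, $u_i = i(2p+1)$ and $v_i = m(2p+1) + \sum_{j=i}^{m-1}\bigl(p+(p+1)x_j\bigr)$. Let $\mathcal{J}_{\bar x}$ be the instance with common processing time $p$ consisting of the $4m$ jobs $A_i,B_i,C_i,D_i$ ($0\le i\le m-1$) with release times $r_{A_i}=u_i$, $r_{B_i}=u_i+1$, $r_{C_i}=u_i+p$, $r_{D_i}=u_i+p+1$, and deadlines: if $x_i=0$, then $d_{A_i}=v_{i+1}+p$, $d_{B_i}=v_{i+1}+2$, $d_{C_i}=u_i+2p$, $d_{D_i}=v_{i+1}+1$; if $x_i=1$, then $d_{A_i}=v_{i+1}+2p+1$, $d_{B_i}=v_{i+1}+2p$, $d_{C_i}=u_i+2p$, $d_{D_i}=v_{i+1}+p$. Let $R_{\bar x}$ be the schedule which, for each $0\le i\le m-1$: if $x_i=0$, starts $B_i$ at $u_i+1$, $D_i$ at $u_i+p+1$, $A_i$ at $v_{i+1}$, and does not schedule $C_i$; if $x_i=1$, starts $A_i$ at $u_i$, $C_i$ at $u_i+p$, $D_i$ at $v_{i+1}$ and $B_i$ at $v_{i+1}+p$. Then $R_{\bar x}$ is an optimal schedule for $\mathcal{J}_{\bar x}$ (i.e. it maximizes the number of completed jobs). Moreover, every optimal schedule for $\mathcal{J}_{\bar x}$ schedules exactly the same jobs as $R_{\bar x}$, in the same order.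
   Context: All jobs have the same processing time $p$ and are processed non-preemptively on a single machine. A schedule assigns starting times $S_j$ to a subset of the jobs such that each scheduled job $j$ satisfies $r_j \le S_j$ and $S_j + p \le d_j$, and the execution intervals $[S_j,S_j+p]$ of scheduled jobs have pairwise disjoint interiors. A schedule is optimal if it maximizes the number of scheduled (completed) jobs. -}

module Defs where

open import Data.Nat using (ℕ; zero; suc; _+_; _*_; _≤_; _<_)
open import Data.Bool using (Bool; true; false; if_then_else_)
open import Data.Fin using (Fin; toℕ) renaming (zero to fzero; suc to fsuc)
open import Data.Maybe using (Maybe; just; nothing; is-just)
open import Data.List using (List; []; _∷_; map; cartesianProduct)
open import Data.Nat.ListAction using (sum)
open import Data.List using (allFin) public
open import Data.Product using (_×_; _,_; proj₁; proj₂)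
open import Data.Sum using (_⊎_)
open import Relation.Binary.PropositionalEquality using (_≡_; _≢_)
open import Function.Bundles using (_⇔_)

-- Generic single-machine scheduling with common processing time p.
-- A schedule assigns to each job an optional start time
-- (nothing = the job is not scheduled).

Schedule : Set → Set
Schedule J = J → Maybe ℕ

Feasible : {J : Set} → (p : ℕ) → (r d : J → ℕ) → Schedule J → Set
Feasible {J} p r d S =
  (∀ (j : J) (s : ℕ) → S j ≡ just s → (r j ≤ s) × (s + p ≤ d j))
  × (∀ (j k : J) (s t : ℕ) → j ≢ k → S j ≡ just s → S k ≡ just t →
       (s + p ≤ t) ⊎ (t + p ≤ s))

scheduledCount : {J : Set} → List J → Schedule J → ℕ
scheduledCount js S = sum (map (λ j → if is-just (S j) then 1 else 0) js)

Optimal : {J : Set} → List J → (p : ℕ) → (r d : J → ℕ) → Schedule J → Set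
Optimal {J} js p r d S =
  Feasible p r d S ×
  (∀ (S' : Schedule J) → Feasible p r d S' → scheduledCount js S' ≤ scheduledCount js S)

SameJobsSameOrder : {J : Set} → Schedule J → Schedule J → Set
SameJobsSameOrder {J} S R =
  (∀ (j : J) → is-just (S j) ≡ is-just (R j))
  × (∀ (j k : J) (s t s' t' : ℕ) → S j ≡ just s → S k ≡ just t →
       R j ≡ just s' → R k ≡ just t' → (s < t) ⇔ (s' < t'))

data Kind : Set where
  A B C D : Kind

-- job (i , K) is K_i
Job : ℕ → Set
Job m = Fin m × Kind

allJobs : (m : ℕ) → List (Job m)
allJobs m = cartesianProduct (allFin m) (A ∷ B ∷ C ∷ D ∷ [])

bit : Bool → ℕ
bit false = 0
bit true  = 1

-- sumFrom f i = Σ_{j = i}^{m-1} f j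
sumFrom : {m : ℕ} → (Fin m → ℕ) → ℕ → ℕ
sumFrom {zero}  f i       = 0
sumFrom {suc m} f zero    = f fzero + sumFrom (λ j → f (fsuc j)) zero
sumFrom {suc m} f (suc i) = sumFrom (λ j → f (fsuc j)) i

module Instance (m p : ℕ) (x : Fin m → Bool) where

  u : ℕ → ℕ
  u i = i * (2 * p + 1)

  v : ℕ → ℕ
  v i = m * (2 * p + 1) + sumFrom (λ j → p + (p + 1) * bit (x j)) i

  rel : Job m → ℕ
  rel (i , A) = u (toℕ i)
  rel (i , B) = u (toℕ i) + 1
  rel (i , C) = u (toℕ i) + p
  rel (i , D) = u (toℕ i) + p + 1

  dl : Job m → ℕ
  dl (i , K) = go (x i) K
    where
    go : Bool → Kind → ℕ
    go false A = v (suc (toℕ i)) + p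
    go false B = v (suc (toℕ i)) + 2
    go false C = u (toℕ i) + 2 * p
    go false D = v (suc (toℕ i)) + 1
    go true  A = v (suc (toℕ i)) + 2 * p + 1
    go true  B = v (suc (toℕ i)) + 2 * p
    go true  C = u (toℕ i) + 2 * p
    go true  D = v (suc (toℕ i)) + p

  R : Schedule (Job m)
  R (i , K) = go (x i) K
    where
    go : Bool → Kind → Maybe ℕ
    go false A = just (v (suc (toℕ i)))
    go false B = just (u (toℕ i) + 1)
    go false C = nothing
    go false D = just (u (toℕ i) + p + 1)
    go true  A = just (u (toℕ i))
    go true  B = just (v (suc (toℕ i)) + p)
    go true  C = just (u (toℕ i) + p)
    go true  D = just (v (suc (toℕ i)))

-- With p ≥ 2m + 3 every release time and deadline of the instance is k * p + e with
-- 0 ≤ e ≤ 2m + 2 < p; call k its slot.  R runs N = 2m + Σᵢ (1 + xᵢ) jobs and every deadline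
-- is below (N + 1) * p, so no feasible schedule runs more than N jobs and R is optimal.  In a
-- schedule running N jobs the k-th job in order of start times starts in [k * p, (k + 1) * p),
-- so its slot k lies between its release slot and its deadline slot.  Going through the blocks
-- i = 0, 1, …, only jobs of block i fit into the slots 2i, 2i + 1 and backSlot i + e (e ≤ xᵢ)
-- that R uses for block i, and these windows, together with the fact that Bᵢ cannot be
-- immediately followed by Cᵢ, force exactly R's jobs into them.

module Submission where

open import Defs
open import Data.Nat using (ℕ; zero; suc; _+_; _*_; _∸_; _≤_; _<_; z≤n; s≤s; s≤s⁻¹; _≤?_)
open import Data.Nat.Properties
open import Data.Nat.ListAction using (sum)
open import Data.Nat.Solver using (module +-*-Solver)
open import Data.Bool using (Bool; true; false; if_then_else_)
open import Data.Fin using (Fin; toℕ; fromℕ<) renaming (zero to fzero; suc to fsuc)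
open import Data.Fin.Properties using (toℕ<n; toℕ-injective)
open import Data.Maybe using (Maybe; just; nothing; is-just)
import Data.Maybe as Maybe
open import Data.Maybe.Properties using (just-injective)
open import Data.List using (List; []; _∷_; length; map; tabulate; cartesianProduct; allFin)
open import Data.List.Membership.Propositional using (_∈_)
open import Data.List.Membership.Propositional.Properties using (∈-allFin; ∈-cartesianProduct⁺)
open import Data.List.Relation.Unary.Any using (here; there)
open import Data.List.Relation.Unary.All as All using (All; []; _∷_)
open import Data.List.Relation.Unary.AllPairs as AllPairs using (AllPairs; []; _∷_)
open import Data.List.Relation.Unary.Unique.Propositional using (Unique)
import Data.List.Relation.Unary.Unique.Propositional.Properties as Unique
open import Data.List.Relation.Unary.Linked.Properties using (Linked⇒AllPairs)
open import Data.List.Relation.Binary.Permutation.Propositional using (↭-sym; ↭⇒↭ₛ)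
open import Data.List.Relation.Binary.Permutation.Propositional.Properties using (∈-resp-↭; ↭-length)
import Data.List.Relation.Binary.Permutation.Setoid.Properties as PermutationSetoid
import Data.List.Sort as Sort
import Relation.Binary.Construct.On as On
open import Data.Product using (∃-syntax; _×_; _,_; proj₁; proj₂)
import Data.Product as Product
open import Data.Sum using (_⊎_; inj₁; inj₂)
import Data.Sum as Sum
open import Data.Empty using (⊥; ⊥-elim)
open import Algebra.Properties.CommutativeSemigroup +-commutativeSemigroup using (interchange)
open import Function using (_∘_)
open import Function.Bundles using (_⇔_; mk⇔)
import Function.Properties.Equivalence as ⇔
open import Relation.Nullary using (¬_; yes; no)
open import Relation.Binary.Definitions using (tri<; tri≈; tri>)
open import Relation.Binary.PropositionalEquality
open +-*-Solver using (solve; _:+_; _:*_; _:=_; con)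

module _ {A : Set} (default : A) where

  nth : List A → ℕ → A
  nth []       _       = default
  nth (y ∷ _)  zero    = y
  nth (_ ∷ ys) (suc k) = nth ys k

  nth-∈ : ∀ {xs k} → k < length xs → nth xs k ∈ xs
  nth-∈ {_ ∷ _}  {zero}  _         = here refl
  nth-∈ {_ ∷ _}  {suc k} (s≤s k<n) = there (nth-∈ k<n)

  ∈⇒nth : ∀ {xs y} → y ∈ xs → ∃[ k ] k < length xs × nth xs k ≡ y
  ∈⇒nth (here refl) = 0 , s≤s z≤n , refl
  ∈⇒nth (there y∈xs) with ∈⇒nth y∈xs
  ... | k , k<n , eq = suc k , s≤s k<n , eq

  AllPairs⇒nth : ∀ {R : A → A → Set} {xs k l} → AllPairs R xs → k < l → l < length xs →
                 R (nth xs k) (nth xs l)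
  AllPairs⇒nth {xs = _ ∷ _} {zero}  {suc l} (r ∷ _)  _         (s≤s l<n) = All.lookup r (nth-∈ l<n)
  AllPairs⇒nth {xs = _ ∷ _} {suc k} {suc l} (_ ∷ rs) (s≤s k<l) (s≤s l<n) = AllPairs⇒nth rs k<l l<n

module Sequencing {J : Set} (p : ℕ) (p≥1 : 1 ≤ p) where

  Disjoint : Schedule J → Set
  Disjoint S = ∀ (j k : J) (s t : ℕ) → j ≢ k → S j ≡ just s → S k ≡ just t →
               (s + p ≤ t) ⊎ (t + p ≤ s)

  Separated : ℕ × J → ℕ × J → Set
  Separated a b = (proj₁ a + p ≤ proj₁ b) ⊎ (proj₁ b + p ≤ proj₁ a)

  Precedes : ℕ × J → ℕ × J → Set
  Precedes a b = proj₁ a + p ≤ proj₁ b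

  startList : Schedule J → List J → List (ℕ × J)
  startList S [] = []
  startList S (j ∷ js) with S j
  ... | just s  = (s , j) ∷ startList S js
  ... | nothing = startList S js

  length-startList : ∀ S js → length (startList S js) ≡ scheduledCount js S
  length-startList S [] = refl
  length-startList S (j ∷ js) with S j
  ... | just _  = cong suc (length-startList S js)
  ... | nothing = length-startList S js

  ∈-startList⁻ : ∀ S js {s j} → (s , j) ∈ startList S js → S j ≡ just s × j ∈ js
  ∈-startList⁻ S (j ∷ js) e∈ with S j in Sj≡
  ∈-startList⁻ S (j ∷ js) (here refl) | just _ = Sj≡ , here refl
  ∈-startList⁻ S (j ∷ js) (there e∈)  | just _ = Product.map₂ there (∈-startList⁻ S js e∈)
  ... | nothing = Product.map₂ there (∈-startList⁻ S js e∈)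

  ∈-startList⁺ : ∀ S js {j s} → j ∈ js → S j ≡ just s → (s , j) ∈ startList S js
  ∈-startList⁺ S (j ∷ js) (here refl) Sj≡ rewrite Sj≡ = here refl
  ∈-startList⁺ S (j ∷ js) (there j∈) Sj≡ with S j
  ... | just _  = there (∈-startList⁺ S js j∈ Sj≡)
  ... | nothing = ∈-startList⁺ S js j∈ Sj≡

  startList-separated : ∀ S js → Unique js → Disjoint S → AllPairs Separated (startList S js)
  startList-separated S [] _ _ = []
  startList-separated S (j ∷ js) (j∉js ∷ unique) disjoint with S j in Sj≡
  ... | just s  = All.tabulate separated ∷ startList-separated S js unique disjoint
    where
    separated : ∀ {e} → e ∈ startList S js → Separated (s , j) e
    separated e∈ with ∈-startList⁻ S js e∈
    ... | Sk≡ , k∈js = disjoint j _ s _ (All.lookup j∉js k∈js) Sj≡ Sk≡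
  ... | nothing = startList-separated S js unique disjoint

  record Enumeration (S : Schedule J) (n : ℕ) : Set where
    field
      job        : ℕ → J
      start      : ℕ → ℕ
      job-start  : ∀ {k} → k < n → S (job k) ≡ just (start k)
      start-gap  : ∀ {k l} → k < l → l < n → start k + p ≤ start l
      enumerates : ∀ {j s} → S j ≡ just s → ∃[ k ] k < n × job k ≡ j

  -- The argument of type J is a junk value, returned as job k for k ≥ n.
  enumerate : ∀ (S : Schedule J) js → J → Unique js → (∀ j → j ∈ js) → Disjoint S →
              Enumeration S (scheduledCount js S)
  enumerate S js default unique complete disjoint = record
    { job        = λ k → proj₂ (nth (0 , default) sorted k)
    ; start      = λ k → proj₁ (nth (0 , default) sorted k)
    ; job-start  = λ k<n → proj₁ (∈-startList⁻ S js (↭-∈ (nth-∈ (0 , default) (<-length k<n))))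
    ; start-gap  = λ k<l l<n → AllPairs⇒nth (0 , default) sorted-precedes k<l (<-length l<n)
    ; enumerates = enumerates
    }
    where
    byStart = On.decTotalOrder ≤-decTotalOrder (proj₁ {B = λ _ → J})
    open Sort byStart
    unsorted = startList S js
    sorted = sort unsorted

    length-sorted : length sorted ≡ scheduledCount js S
    length-sorted = trans (↭-length (sort-↭ unsorted)) (length-startList S js)

    <-length : ∀ {k} → k < scheduledCount js S → k < length sorted
    <-length = subst (_ <_) (sym length-sorted)

    <-count : ∀ {k} → k < length sorted → k < scheduledCount js S
    <-count = subst (_ <_) length-sorted

    ↭-∈ : ∀ {e} → e ∈ sorted → e ∈ unsorted
    ↭-∈ = ∈-resp-↭ (sort-↭ unsorted)

    precedes : ∀ {a b} → proj₁ a ≤ proj₁ b → Separated a b → Precedes a b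
    precedes _   (inj₁ a≺b) = a≺b
    precedes a≤b (inj₂ b≺a) =
      ⊥-elim (<-irrefl refl (<-≤-trans (m<m+n _ p≥1) (≤-trans b≺a a≤b)))

    sorted-precedes : AllPairs Precedes sorted
    sorted-precedes = AllPairs.zipWith (λ {a} {b} (a≤b , sep) → precedes {a} {b} a≤b sep)
      ( Linked⇒AllPairs (λ {a} {b} {c} → ≤-trans {proj₁ a} {proj₁ b} {proj₁ c}) (sort-↗ unsorted)
      , PermutationSetoid.AllPairs-resp-↭ (setoid _)
          (λ {a} {b} → Sum.swap {A = proj₁ a + p ≤ proj₁ b}) (resp₂ Separated)
          (↭⇒↭ₛ (↭-sym (sort-↭ unsorted))) (startList-separated S js unique disjoint))

    enumerates : ∀ {j s} → S j ≡ just s →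
                 ∃[ k ] k < scheduledCount js S × proj₂ (nth (0 , default) sorted k) ≡ j
    enumerates Sj≡
      with ∈⇒nth (0 , default) (∈-resp-↭ (↭-sym (sort-↭ unsorted))
                                  (∈-startList⁺ S js (complete _) Sj≡))
    ... | k , k<n , eq = k , <-count k<n , cong proj₂ eq

  module _ {S : Schedule J} {n : ℕ} (E : Enumeration S n) where
    open Enumeration E

    start-< : ∀ {k l} → k < l → l < n → start k < start l
    start-< k<l l<n = <-≤-trans (m<m+n _ p≥1) (start-gap k<l l<n)

    same-start : ∀ {k l} → k < n → l < n → job k ≡ job l → start k ≡ start l
    same-start k<n l<n jk≡jl =
      just-injective (trans (sym (job-start k<n)) (trans (cong S jk≡jl) (job-start l<n)))

    job-injective : ∀ {k l} → k < n → l < n → job k ≡ job l → k ≡ l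
    job-injective {k} {l} k<n l<n jk≡jl with <-cmp k l
    ... | tri≈ _ k≡l _ = k≡l
    ... | tri< k<l _ _ = ⊥-elim (<-irrefl (same-start k<n l<n jk≡jl) (start-< k<l l<n))
    ... | tri> _ _ l<k = ⊥-elim (<-irrefl (same-start l<n k<n (sym jk≡jl)) (start-< l<k k<n))

    start-lower : ∀ {k} → k < n → k * p ≤ start k
    start-lower {zero}  _   = z≤n
    start-lower {suc k} k<n = begin
      suc k * p   ≡⟨ +-comm p (k * p) ⟩
      k * p + p   ≤⟨ +-monoˡ-≤ p (start-lower (<-trans (n<1+n k) k<n)) ⟩
      start k + p ≤⟨ start-gap (n<1+n k) k<n ⟩
      start (suc k) ∎
      where open ≤-Reasoning hiding (start)

    start-+ : ∀ {k} d → k + d < n → start k + d * p ≤ start (k + d)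
    start-+ {k} zero    _      =
      ≤-reflexive (trans (+-identityʳ (start k)) (cong start (sym (+-identityʳ k))))
    start-+ {k} (suc d) k+d<n = begin
      start k + (p + d * p)    ≡⟨ sym (+-assoc (start k) p (d * p)) ⟩
      start k + p + d * p      ≤⟨ +-monoˡ-≤ (d * p) (start-gap (n<1+n k) 1+k<n) ⟩
      start (suc k) + d * p    ≤⟨ start-+ d 1+k+d<n ⟩
      start (suc k + d)        ≡⟨ cong start (sym (+-suc k d)) ⟩
      start (k + suc d)        ∎
      where
      open ≤-Reasoning hiding (start)
      1+k+d<n : suc k + d < n
      1+k+d<n = subst (_< n) (+-suc k d) k+d<n
      1+k<n : suc k < n
      1+k<n = ≤-<-trans (m≤m+n (suc k) d) 1+k+d<n

    fits-before : ∀ {T} → (∀ {k} → k < n → start k + p < T) → ∀ {k d} → suc k + d ≡ n →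
                  start k + suc d * p < T
    fits-before {T} ends {k} {d} refl = begin-strict
      start k + (p + d * p)  ≡⟨ cong (start k +_) (+-comm p (d * p)) ⟩
      start k + (d * p + p)  ≡⟨ sym (+-assoc (start k) (d * p) p) ⟩
      start k + d * p + p    ≤⟨ +-monoˡ-≤ p (start-+ d ≤-refl) ⟩
      start (k + d) + p      <⟨ ends ≤-refl ⟩
      T                      ∎
      where open ≤-Reasoning hiding (start)

    all-fit-before : ∀ {T} → 0 < T → (∀ {k} → k < n → start k + p < T) → n * p < T
    all-fit-before {T} 0<T ends = go n refl
      where
      go : ∀ n' → n' ≡ n → n' * p < T
      go zero    _  = 0<T
      go (suc d) eq = ≤-<-trans (m≤n+m (suc d * p) (start 0)) (fits-before ends eq)

module SlotAssignment {J : Set} (slot : J → Maybe ℕ) (N : ℕ) where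

  record Realises (S : Schedule J) : Set where
    field
      start     : ℕ → ℕ
      start-<   : ∀ {k l} → k < l → l < N → start k < start l
      slotted   : ∀ {j k} → slot j ≡ just k → S j ≡ just (start k)
      slotted⁻  : ∀ {j s} → S j ≡ just s → ∃[ k ] slot j ≡ just k

  module _ {S : Schedule J} (ρ : Realises S) where
    open Realises ρ

    is-just-slot : ∀ j → is-just (S j) ≡ is-just (slot j)
    is-just-slot j with slot j in slot≡ | S j in S≡
    ... | just _  | just _  = refl
    ... | nothing | nothing = refl
    ... | just _  | nothing with () ← trans (sym (slotted slot≡)) S≡
    ... | nothing | just _ with slotted⁻ S≡
    ...   | _ , slot≡' with () ← trans (sym slot≡) slot≡'

    start-of : ∀ {j s} → S j ≡ just s → ∃[ k ] slot j ≡ just k × start k ≡ s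
    start-of Sj≡ with slotted⁻ Sj≡
    ... | k , slot≡ = k , slot≡ , just-injective (trans (sym (slotted slot≡)) Sj≡)

    start-<⇔ : ∀ {k l} → k < N → l < N → start k < start l ⇔ k < l
    start-<⇔ {k} {l} k<N l<N = mk⇔ reflect (λ k<l → start-< k<l l<N)
      where
      reflect : start k < start l → k < l
      reflect sk<sl with <-cmp k l
      ... | tri< k<l _ _ = k<l
      ... | tri≈ _ refl _ = ⊥-elim (<-irrefl refl sk<sl)
      ... | tri> _ _ l<k = ⊥-elim (<-asym sk<sl (start-< l<k k<N))

  same-jobs-same-order : (∀ {j k} → slot j ≡ just k → k < N) →
                         ∀ {S S'} → Realises S → Realises S' → SameJobsSameOrder S S'
  same-jobs-same-order slot<N {S} {S'} ρ ρ' =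
    (λ j → trans (is-just-slot ρ j) (sym (is-just-slot ρ' j))) , same-order
    where
    same-order : ∀ j k s t s' t' → S j ≡ just s → S k ≡ just t →
                 S' j ≡ just s' → S' k ≡ just t' → (s < t) ⇔ (s' < t')
    same-order j k s t s' t' Sj≡ Sk≡ S'j≡ S'k≡
      with start-of ρ Sj≡ | start-of ρ Sk≡ | start-of ρ' S'j≡ | start-of ρ' S'k≡
    ... | a , slot-j , refl | c , slot-k , refl | a' , slot-j' , refl | c' , slot-k' , refl
      with just-injective (trans (sym slot-j) slot-j') | just-injective (trans (sym slot-k) slot-k')
    ... | refl | refl = ⇔.trans
                          (start-<⇔ ρ (slot<N slot-j) (slot<N slot-k))
                          (⇔.sym (start-<⇔ ρ' (slot<N slot-j) (slot<N slot-k)))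

sumFrom-cong : ∀ {m} {f g : Fin m → ℕ} → (∀ j → f j ≡ g j) → ∀ n →
               sumFrom f n ≡ sumFrom g n
sumFrom-cong {zero}  f≗g n       = refl
sumFrom-cong {suc m} f≗g zero    = cong₂ _+_ (f≗g fzero) (sumFrom-cong (f≗g ∘ fsuc) zero)
sumFrom-cong {suc m} f≗g (suc n) = sumFrom-cong (f≗g ∘ fsuc) n

sumFrom-+ : ∀ {m} (f g : Fin m → ℕ) n → sumFrom (λ j → f j + g j) n ≡ sumFrom f n + sumFrom g n
sumFrom-+ {zero}  f g n       = refl
sumFrom-+ {suc m} f g zero    =
  trans (cong (f fzero + g fzero +_) (sumFrom-+ (f ∘ fsuc) (g ∘ fsuc) zero))
        (interchange (f fzero) (g fzero) _ _)
sumFrom-+ {suc m} f g (suc n) = sumFrom-+ (f ∘ fsuc) (g ∘ fsuc) n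

sumFrom-*ˡ : ∀ {m} c (f : Fin m → ℕ) n → sumFrom (λ j → c * f j) n ≡ c * sumFrom f n
sumFrom-*ˡ {zero}  c f n       = sym (*-zeroʳ c)
sumFrom-*ˡ {suc m} c f zero    =
  trans (cong (c * f fzero +_) (sumFrom-*ˡ c (f ∘ fsuc) zero)) (sym (*-distribˡ-+ c (f fzero) _))
sumFrom-*ˡ {suc m} c f (suc n) = sumFrom-*ˡ c (f ∘ fsuc) n

sumFrom-const : ∀ {m} c → sumFrom {m} (λ _ → c) 0 ≡ c * m
sumFrom-const {zero}  c = sym (*-zeroʳ c)
sumFrom-const {suc m} c = trans (cong (c +_) (sumFrom-const c)) (sym (*-suc c m))

sumFrom-step : ∀ {m} (f : Fin m → ℕ) i → sumFrom f (toℕ i) ≡ f i + sumFrom f (suc (toℕ i))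
sumFrom-step f fzero    = refl
sumFrom-step f (fsuc i) = sumFrom-step (f ∘ fsuc) i

sumFrom-antitone : ∀ {m} (f : Fin m → ℕ) {n n'} → n ≤ n' → sumFrom f n' ≤ sumFrom f n
sumFrom-antitone {zero}  f _ = z≤n
sumFrom-antitone {suc m} f {zero} {zero}   _ = ≤-refl
sumFrom-antitone {suc m} f {zero} {suc n'} _ =
  ≤-trans (sumFrom-antitone (f ∘ fsuc) {zero} {n'} z≤n) (m≤n+m _ (f fzero))
sumFrom-antitone {suc m} f {suc n} {suc n'} (s≤s n≤n') = sumFrom-antitone (f ∘ fsuc) n≤n'

sumFrom-≤ : ∀ {m} (f : Fin m → ℕ) → (∀ j → f j ≤ 1) → ∀ n → sumFrom f n ≤ m
sumFrom-≤ {zero}  f f≤1 n       = z≤n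
sumFrom-≤ {suc m} f f≤1 zero    = +-mono-≤ (f≤1 fzero) (sumFrom-≤ (f ∘ fsuc) (f≤1 ∘ fsuc) zero)
sumFrom-≤ {suc m} f f≤1 (suc n) = m≤n⇒m≤1+n (sumFrom-≤ (f ∘ fsuc) (f≤1 ∘ fsuc) n)

sum-map-tabulate : ∀ {A : Set} {m} (f : A → ℕ) (g : Fin m → A) →
                   sum (map f (tabulate g)) ≡ sumFrom (f ∘ g) 0
sum-map-tabulate {m = zero}  f g = refl
sum-map-tabulate {m = suc m} f g = cong (f (g fzero) +_) (sum-map-tabulate f (g ∘ fsuc))

neither-A-nor-B : ∀ {K₁ K₂ K} → K₁ ≡ A ⊎ K₁ ≡ B → K₂ ≡ A ⊎ K₂ ≡ B →
                  K₁ ≢ K₂ → K₁ ≢ K → K₂ ≢ K → K ≡ C ⊎ K ≡ D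
neither-A-nor-B {K = C} _ _ _ _ _ = inj₁ refl
neither-A-nor-B {K = D} _ _ _ _ _ = inj₂ refl
neither-A-nor-B {K = A} (inj₁ refl) _           _     K₁≢K _     = ⊥-elim (K₁≢K refl)
neither-A-nor-B {K = A} (inj₂ refl) (inj₁ refl) _     _     K₂≢K = ⊥-elim (K₂≢K refl)
neither-A-nor-B {K = A} (inj₂ refl) (inj₂ refl) K₁≢K₂ _     _     = ⊥-elim (K₁≢K₂ refl)
neither-A-nor-B {K = B} (inj₂ refl) _           _     K₁≢K _     = ⊥-elim (K₁≢K refl)
neither-A-nor-B {K = B} (inj₁ refl) (inj₂ refl) _     _     K₂≢K = ⊥-elim (K₂≢K refl)
neither-A-nor-B {K = B} (inj₁ refl) (inj₁ refl) K₁≢K₂ _     _     = ⊥-elim (K₁≢K₂ refl)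

kinds-false : ∀ {front₀ front₁ back₀} → front₀ ≡ A ⊎ front₀ ≡ B → back₀ ≡ A →
              front₀ ≢ front₁ → front₀ ≢ back₀ → back₀ ≢ front₁ →
              ¬ (front₀ ≡ B × front₁ ≡ C) → front₀ ≡ B × front₁ ≡ D
kinds-false (inj₁ refl) refl _ ≢back₀ _ _ = ⊥-elim (≢back₀ refl)
kinds-false (inj₂ refl) refl ≢front₁ _ back₀≢ no-BC
  with neither-A-nor-B (inj₁ refl) (inj₂ refl) (λ ()) back₀≢ ≢front₁
... | inj₁ refl = ⊥-elim (no-BC (refl , refl))
... | inj₂ refl = refl , refl

kinds-true : ∀ {front₀ front₁ back₀ back₁} →
             front₀ ≡ A ⊎ front₀ ≡ B → back₁ ≡ A ⊎ back₁ ≡ B → back₀ ≢ C →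
             front₀ ≢ front₁ → front₀ ≢ back₀ → front₀ ≢ back₁ →
             back₁ ≢ front₁ → back₁ ≢ back₀ → front₁ ≢ back₀ →
             ¬ (front₀ ≡ B × front₁ ≡ C) →
             front₀ ≡ A × front₁ ≡ C × back₀ ≡ D × back₁ ≡ B
kinds-true f₀∈ b₁∈ b₀≢C f₀≢f₁ f₀≢b₀ f₀≢b₁ b₁≢f₁ b₁≢b₀ f₁≢b₀ no-BC
  with neither-A-nor-B f₀∈ b₁∈ f₀≢b₁ f₀≢b₀ b₁≢b₀
... | inj₁ refl = ⊥-elim (b₀≢C refl)
... | inj₂ refl with neither-A-nor-B f₀∈ b₁∈ f₀≢b₁ f₀≢f₁ b₁≢f₁
...   | inj₂ refl = ⊥-elim (f₁≢b₀ refl)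
...   | inj₁ refl with f₀∈ | b₁∈
...     | inj₂ refl | _         = ⊥-elim (no-BC (refl , refl))
...     | inj₁ refl | inj₁ refl = ⊥-elim (f₀≢b₁ refl)
...     | inj₁ refl | inj₂ refl = refl , refl , refl , refl

module Slots (p : ℕ) where

  +p-nextSlot : ∀ k e → k * p + e + p ≡ suc k * p + e
  +p-nextSlot k e = solve 3 (λ k e p → k :* p :+ e :+ p := (con 1 :+ k) :* p :+ e) refl k e p

  slot-mono : ∀ {k k' e e'} → k ≤ k' → e ≤ e' → k * p + e ≤ k' * p + e'
  slot-mono k≤k' e≤e' = +-mono-≤ (*-monoˡ-≤ p k≤k') e≤e'

  separated : ∀ {k k' e e'} → k < k' → e ≤ e' → k * p + e + p ≤ k' * p + e'
  separated {k} {e = e} k<k' e≤e' = ≤-trans (≤-reflexive (+p-nextSlot k e)) (slot-mono k<k' e≤e')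

  within-slot : ∀ k {e} → e < p → k * p + e < suc k * p
  within-slot k e<p = <-≤-trans (+-monoʳ-< (k * p) e<p) (≤-reflexive (+-comm (k * p) p))

module Reduction (m p : ℕ) (x : Fin m → Bool) (p-large : 2 * m + 3 ≤ p) where
  open Instance m p x
  open Slots p

  b : Fin m → ℕ
  b i = bit (x i)

  onesFrom backCount : ℕ → ℕ
  onesFrom  = sumFrom b
  backCount = sumFrom (λ j → suc (b j))

  backSlot backOffset : Fin m → ℕ
  backSlot   i = 2 * m + backCount (suc (toℕ i))
  backOffset i = m + onesFrom (suc (toℕ i))

  N : ℕ
  N = 2 * m + backCount 0

  v-slots : ∀ n → v n ≡ (2 * m + backCount n) * p + (m + onesFrom n)
  v-slots n = begin
    m * (2 * p + 1) + sumFrom (λ j → p + (p + 1) * b j) n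
      ≡⟨ cong (m * (2 * p + 1) +_) (sumFrom-cong regroup n) ⟩
    m * (2 * p + 1) + sumFrom (λ j → p * suc (b j) + b j) n
      ≡⟨ cong (m * (2 * p + 1) +_) (sumFrom-+ (λ j → p * suc (b j)) b n) ⟩
    m * (2 * p + 1) + (sumFrom (λ j → p * suc (b j)) n + onesFrom n)
      ≡⟨ cong (λ s → m * (2 * p + 1) + (s + onesFrom n)) (sumFrom-*ˡ p (λ j → suc (b j)) n) ⟩
    m * (2 * p + 1) + (p * backCount n + onesFrom n)
      ≡⟨ solve 4 (λ m p h c → m :* (con 2 :* p :+ con 1) :+ (p :* h :+ c)
                              := (con 2 :* m :+ h) :* p :+ (m :+ c))
                 refl m p (backCount n) (onesFrom n) ⟩
    (2 * m + backCount n) * p + (m + onesFrom n) ∎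
    where
    open ≡-Reasoning
    regroup : ∀ j → p + (p + 1) * b j ≡ p * suc (b j) + b j
    regroup j = solve 2 (λ p c → p :+ (p :+ con 1) :* c := p :* (con 1 :+ c) :+ c) refl p (b j)

  b≤1 : ∀ i → b i ≤ 1
  b≤1 i with x i
  ... | false = z≤n
  ... | true  = ≤-refl

  small<p : ∀ {e} → e ≤ 2 * m + 2 → e < p
  small<p e≤ = ≤-trans (s≤s e≤) (≤-trans (≤-reflexive (sym (+-suc (2 * m) 2))) p-large)

  1≤p : 1 ≤ p
  1≤p = small<p z≤n

  onesFrom≤m : ∀ n → onesFrom n ≤ m
  onesFrom≤m = sumFrom-≤ b b≤1

  m≤2m+2 : m ≤ 2 * m + 2
  m≤2m+2 = ≤-trans (m≤m+n m (m + 0)) (m≤m+n (2 * m) 2)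

  toℕ<p : ∀ (i : Fin m) → toℕ i < p
  toℕ<p i = small<p (≤-trans (<⇒≤ (toℕ<n i)) m≤2m+2)

  backOffset+2<p : ∀ i → backOffset i + 2 < p
  backOffset+2<p i =
    small<p (+-monoˡ-≤ 2 (+-monoʳ-≤ m (≤-trans (onesFrom≤m (suc (toℕ i))) (m≤m+n m 0))))

  m≤backOffset : ∀ i → m ≤ backOffset i
  m≤backOffset i = m≤m+n m _

  backOffset-antitone : ∀ {i i'} → toℕ i ≤ toℕ i' → backOffset i' ≤ backOffset i
  backOffset-antitone i≤i' = +-monoʳ-≤ m (sumFrom-antitone b (s≤s i≤i'))

  frontSlots<backSlot : ∀ i i' → 2 + 2 * toℕ i ≤ backSlot i'
  frontSlots<backSlot i i' = begin
    2 + 2 * toℕ i ≡⟨ sym (*-suc 2 (toℕ i)) ⟩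
    2 * suc (toℕ i) ≤⟨ *-monoʳ-≤ 2 {suc (toℕ i)} {m} (toℕ<n i) ⟩
    2 * m ≤⟨ m≤m+n (2 * m) _ ⟩
    backSlot i' ∎
    where open ≤-Reasoning

  backSlots-within : ∀ {n} i → n ≤ toℕ i → backSlot i + b i < 2 * m + backCount n
  backSlots-within {n} i n≤i = begin-strict
    backSlot i + b i
      <⟨ n<1+n _ ⟩
    suc (2 * m + backCount (suc (toℕ i)) + b i)
      ≡⟨ solve 3 (λ m c d → con 1 :+ (con 2 :* m :+ c :+ d) := con 2 :* m :+ ((con 1 :+ d) :+ c))
               refl m (backCount (suc (toℕ i))) (b i) ⟩
    2 * m + (suc (b i) + backCount (suc (toℕ i)))
      ≡⟨ cong (2 * m +_) (sym (sumFrom-step (λ j → suc (b j)) i)) ⟩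
    2 * m + backCount (toℕ i)
      ≤⟨ +-monoʳ-≤ (2 * m) (sumFrom-antitone (λ j → suc (b j)) n≤i) ⟩
    2 * m + backCount n ∎
    where open ≤-Reasoning

  backSlot-decreasing : ∀ {i i'} → toℕ i < toℕ i' → backSlot i' + b i' < backSlot i
  backSlot-decreasing {i' = i'} = backSlots-within i'

  backSlots<N : ∀ i → backSlot i + b i < N
  backSlots<N i = backSlots-within i z≤n

  releaseSlot releaseOffset : Job m → ℕ
  releaseSlot (i , A) = 2 * toℕ i
  releaseSlot (i , B) = 2 * toℕ i
  releaseSlot (i , C) = suc (2 * toℕ i)
  releaseSlot (i , D) = suc (2 * toℕ i)
  releaseOffset (i , A) = toℕ i
  releaseOffset (i , B) = suc (toℕ i)
  releaseOffset (i , C) = toℕ i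
  releaseOffset (i , D) = suc (toℕ i)

  deadlineSlotB deadlineOffsetB : Bool → Fin m → Kind → ℕ
  deadlineSlotB false i A = suc (backSlot i)
  deadlineSlotB false i B = backSlot i
  deadlineSlotB false i C = 2 + 2 * toℕ i
  deadlineSlotB false i D = backSlot i
  deadlineSlotB true  i A = 2 + backSlot i
  deadlineSlotB true  i B = 2 + backSlot i
  deadlineSlotB true  i C = 2 + 2 * toℕ i
  deadlineSlotB true  i D = suc (backSlot i)
  deadlineOffsetB false i A = backOffset i
  deadlineOffsetB false i B = backOffset i + 2
  deadlineOffsetB false i C = toℕ i
  deadlineOffsetB false i D = backOffset i + 1
  deadlineOffsetB true  i A = backOffset i + 1
  deadlineOffsetB true  i B = backOffset i
  deadlineOffsetB true  i C = toℕ i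
  deadlineOffsetB true  i D = backOffset i

  deadlineSlot deadlineOffset : Job m → ℕ
  deadlineSlot   (i , K) = deadlineSlotB (x i) i K
  deadlineOffset (i , K) = deadlineOffsetB (x i) i K

  deadlineOffset<p : ∀ j → deadlineOffset j < p
  deadlineOffset<p (i , K) with x i
  deadlineOffset<p (i , A) | false = <-trans (m<m+n _ 0<1+n) (backOffset+2<p i)
  deadlineOffset<p (i , B) | false = backOffset+2<p i
  deadlineOffset<p (i , C) | false = toℕ<p i
  deadlineOffset<p (i , D) | false = <-trans (+-monoʳ-< (backOffset i) (n<1+n 1)) (backOffset+2<p i)
  deadlineOffset<p (i , A) | true  = <-trans (+-monoʳ-< (backOffset i) (n<1+n 1)) (backOffset+2<p i)
  deadlineOffset<p (i , B) | true  = <-trans (m<m+n _ 0<1+n) (backOffset+2<p i)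
  deadlineOffset<p (i , C) | true  = toℕ<p i
  deadlineOffset<p (i , D) | true  = <-trans (m<m+n _ 0<1+n) (backOffset+2<p i)

  v-backSlot : ∀ i → v (suc (toℕ i)) ≡ backSlot i * p + backOffset i
  v-backSlot i = v-slots (suc (toℕ i))

  u+2p-slots : ∀ (i : Fin m) → u (toℕ i) + 2 * p ≡ (2 + 2 * toℕ i) * p + toℕ i
  u+2p-slots i = solve 2 (λ t p → t :* (con 2 :* p :+ con 1) :+ con 2 :* p
                                 := (con 2 :+ con 2 :* t) :* p :+ t) refl (toℕ i) p

  release-slots : ∀ j → rel j ≡ releaseSlot j * p + releaseOffset j
  release-slots (i , A) = solve 2 (λ t p → t :* (con 2 :* p :+ con 1)
                                          := con 2 :* t :* p :+ t) refl (toℕ i) p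
  release-slots (i , B) = solve 2 (λ t p → t :* (con 2 :* p :+ con 1) :+ con 1
                                          := con 2 :* t :* p :+ (con 1 :+ t)) refl (toℕ i) p
  release-slots (i , C) = solve 2 (λ t p → t :* (con 2 :* p :+ con 1) :+ p
                                          := (con 1 :+ con 2 :* t) :* p :+ t) refl (toℕ i) p
  release-slots (i , D) = solve 2 (λ t p → t :* (con 2 :* p :+ con 1) :+ p :+ con 1
                                          := (con 1 :+ con 2 :* t) :* p :+ (con 1 :+ t)) refl (toℕ i) p

  deadline-slots : ∀ j → dl j ≡ deadlineSlot j * p + deadlineOffset j
  deadline-slots (i , K) with x i
  deadline-slots (i , A) | false =
    trans (cong (_+ p) (v-backSlot i)) (+p-nextSlot (backSlot i) (backOffset i))
  deadline-slots (i , B) | false = trans (cong (_+ 2) (v-backSlot i)) (+-assoc (backSlot i * p) _ 2)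
  deadline-slots (i , C) | false = u+2p-slots i
  deadline-slots (i , D) | false = trans (cong (_+ 1) (v-backSlot i)) (+-assoc (backSlot i * p) _ 1)
  deadline-slots (i , A) | true  = trans (cong (λ s → s + 2 * p + 1) (v-backSlot i))
    (solve 3 (λ k e p → k :* p :+ e :+ con 2 :* p :+ con 1 := (con 2 :+ k) :* p :+ (e :+ con 1))
           refl (backSlot i) (backOffset i) p)
  deadline-slots (i , B) | true  = trans (cong (_+ 2 * p) (v-backSlot i))
    (solve 3 (λ k e p → k :* p :+ e :+ con 2 :* p := (con 2 :+ k) :* p :+ e)
           refl (backSlot i) (backOffset i) p)
  deadline-slots (i , C) | true  = u+2p-slots i
  deadline-slots (i , D) | true  =
    trans (cong (_+ p) (v-backSlot i)) (+p-nextSlot (backSlot i) (backOffset i))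

  deadline<nextSlot : ∀ j → dl j < suc (deadlineSlot j) * p
  deadline<nextSlot j =
    ≤-<-trans (≤-reflexive (deadline-slots j)) (within-slot (deadlineSlot j) (deadlineOffset<p j))

  frontOffset : Bool → ℕ → ℕ
  frontOffset false t = suc t
  frontOffset true  t = t

  slotB : Bool → Fin m → Kind → Maybe ℕ
  slotB false i A = just (backSlot i)
  slotB false i B = just (2 * toℕ i)
  slotB false i C = nothing
  slotB false i D = just (suc (2 * toℕ i))
  slotB true  i A = just (2 * toℕ i)
  slotB true  i B = just (suc (backSlot i))
  slotB true  i C = just (suc (2 * toℕ i))
  slotB true  i D = just (backSlot i)

  offsetB : Bool → Fin m → Kind → ℕ
  offsetB false i A = backOffset i
  offsetB false i B = frontOffset false (toℕ i)
  offsetB false i C = 0  -- junk: R does not schedule Cᵢ when xᵢ = 0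
  offsetB false i D = frontOffset false (toℕ i)
  offsetB true  i A = frontOffset true (toℕ i)
  offsetB true  i B = backOffset i
  offsetB true  i C = frontOffset true (toℕ i)
  offsetB true  i D = backOffset i

  slot : Job m → Maybe ℕ
  slot (i , K) = slotB (x i) i K

  offset : Job m → ℕ
  offset (i , K) = offsetB (x i) i K

  R-slots : ∀ j → R j ≡ Maybe.map (λ k → k * p + offset j) (slot j)
  R-slots (i , K) with x i
  R-slots (i , A) | false = cong just (v-backSlot i)
  R-slots (i , B) | false = cong just (release-slots (i , B))
  R-slots (i , C) | false = refl
  R-slots (i , D) | false = cong just (release-slots (i , D))
  R-slots (i , A) | true  = cong just (release-slots (i , A))
  R-slots (i , B) | true  =
    cong just (trans (cong (_+ p) (v-backSlot i)) (+p-nextSlot (backSlot i) (backOffset i)))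
  R-slots (i , C) | true  = cong just (release-slots (i , C))
  R-slots (i , D) | true  = cong just (v-backSlot i)

  R-start : ∀ j {s} → R j ≡ just s → ∃[ k ] slot j ≡ just k × k * p + offset j ≡ s
  R-start j Rj≡ with slot j | R-slots j
  ... | just k  | R≡ = k , refl , just-injective (trans (sym R≡) Rj≡)
  ... | nothing | R≡ = ⊥-elim (nothing≢just (trans (sym R≡) Rj≡))
    where
    nothing≢just : ∀ {s} → nothing ≢ just s
    nothing≢just ()

  toℕ<backOffset : ∀ i → toℕ i < backOffset i
  toℕ<backOffset i = ≤-trans (toℕ<n i) (m≤backOffset i)

  R-within-window : ∀ β i K {k} → slotB β i K ≡ just k →
    releaseSlot (i , K) ≤ k × releaseOffset (i , K) ≤ offsetB β i K ×
    suc k ≤ deadlineSlotB β i K × offsetB β i K ≤ deadlineOffsetB β i K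
  R-within-window false i A refl =
    ≤-trans (m≤n+m _ 2) (frontSlots<backSlot i i) , <⇒≤ (toℕ<backOffset i) , ≤-refl , ≤-refl
  R-within-window false i B refl =
    ≤-refl , ≤-refl , ≤-trans (n≤1+n _) (frontSlots<backSlot i i) ,
    ≤-trans (toℕ<backOffset i) (m≤m+n _ 2)
  R-within-window false i C ()
  R-within-window false i D refl =
    ≤-refl , ≤-refl , frontSlots<backSlot i i , ≤-trans (toℕ<backOffset i) (m≤m+n _ 1)
  R-within-window true  i A refl =
    ≤-refl , ≤-refl , ≤-trans (n≤1+n _) (≤-trans (frontSlots<backSlot i i) (m≤n+m _ 2)) ,
    ≤-trans (<⇒≤ (toℕ<backOffset i)) (m≤m+n _ 1)
  R-within-window true  i B refl =
    ≤-trans (m≤n+m _ 2) (≤-trans (frontSlots<backSlot i i) (n≤1+n _)) , toℕ<backOffset i ,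
    ≤-refl , ≤-refl
  R-within-window true  i C refl = ≤-refl , ≤-refl , ≤-refl , ≤-refl
  R-within-window true  i D refl =
    ≤-trans (n≤1+n _) (frontSlots<backSlot i i) , toℕ<backOffset i , ≤-refl , ≤-refl

  R-respects-windows : ∀ j s → R j ≡ just s → rel j ≤ s × s + p ≤ dl j
  R-respects-windows (i , K) _ Rj≡ with R-start (i , K) Rj≡
  ... | k , slot≡ , refl with R-within-window (x i) i K slot≡
  ...   | r≤k , r≤δ , k<d , δ≤d =
    ≤-trans (≤-reflexive (release-slots (i , K))) (slot-mono r≤k r≤δ) ,
    ≤-trans (≤-reflexive (+p-nextSlot k (offset (i , K))))
            (≤-trans (slot-mono k<d δ≤d) (≤-reflexive (sym (deadline-slots (i , K)))))

  frontKind : Bool → ℕ → Kind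
  frontKind false zero    = B
  frontKind false (suc _) = D
  frontKind true  zero    = A
  frontKind true  (suc _) = C

  backKind : Bool → ℕ → Kind
  backKind false _       = A
  backKind true  zero    = D
  backKind true  (suc _) = B

  data Placed (β : Bool) (i : Fin m) (K : Kind) (k : ℕ) : Set where
    front : ∀ e → e ≤ 1     → k ≡ 2 * toℕ i + e  → K ≡ frontKind β e → Placed β i K k
    back  : ∀ e → e ≤ bit β → k ≡ backSlot i + e → K ≡ backKind β e  → Placed β i K k

  placed : ∀ β i K {k} → slotB β i K ≡ just k → Placed β i K k
  placed false i A refl = back  0 z≤n    (sym (+-identityʳ _))          refl
  placed false i B refl = front 0 z≤n    (sym (+-identityʳ _))          refl
  placed false i C ()
  placed false i D refl = front 1 ≤-refl (sym (+-comm (2 * toℕ i) 1)) refl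
  placed true  i A refl = front 0 z≤n    (sym (+-identityʳ _))          refl
  placed true  i B refl = back  1 ≤-refl (sym (+-comm (backSlot i) 1))  refl
  placed true  i C refl = front 1 ≤-refl (sym (+-comm (2 * toℕ i) 1)) refl
  placed true  i D refl = back  0 z≤n    (sym (+-identityʳ _))          refl

  offset-front : ∀ β i {e} → e ≤ 1 → offsetB β i (frontKind β e) ≡ frontOffset β (toℕ i)
  offset-front false i {zero}  _ = refl
  offset-front false i {suc _} _ = refl
  offset-front true  i {zero}  _ = refl
  offset-front true  i {suc _} _ = refl

  offset-back : ∀ β i {e} → e ≤ bit β → offsetB β i (backKind β e) ≡ backOffset i
  offset-back false i z≤n             = refl
  offset-back true  i {zero}  _       = refl
  offset-back true  i {suc _} _       = refl

  frontOffset≤ : ∀ β t → frontOffset β t ≤ suc t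
  frontOffset≤ false t = ≤-refl
  frontOffset≤ true  t = n≤1+n t

  ≤frontOffset : ∀ β t → t ≤ frontOffset β t
  ≤frontOffset false t = n≤1+n t
  ≤frontOffset true  t = ≤-refl

  front-< : ∀ {i i' : Fin m} {e} → toℕ i < toℕ i' → e ≤ 1 → 2 * toℕ i + e < 2 * toℕ i'
  front-< {i} {i'} {e} i<i' e≤1 = begin-strict
    2 * toℕ i + e    ≤⟨ +-monoʳ-≤ (2 * toℕ i) e≤1 ⟩
    2 * toℕ i + 1    <⟨ ≤-reflexive (cong suc (+-comm (2 * toℕ i) 1)) ⟩
    2 + 2 * toℕ i    ≡⟨ sym (*-suc 2 (toℕ i)) ⟩
    2 * suc (toℕ i)  ≤⟨ *-monoʳ-≤ 2 i<i' ⟩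
    2 * toℕ i'       ∎
    where open ≤-Reasoning

  front<back : ∀ {i i' : Fin m} {e e'} → e ≤ 1 → 2 * toℕ i + e < backSlot i' + e'
  front<back {i} {i'} {e} {e'} e≤1 = begin-strict
    2 * toℕ i + e    ≤⟨ +-monoʳ-≤ (2 * toℕ i) e≤1 ⟩
    2 * toℕ i + 1    <⟨ ≤-reflexive (cong suc (+-comm (2 * toℕ i) 1)) ⟩
    2 + 2 * toℕ i    ≤⟨ frontSlots<backSlot i i' ⟩
    backSlot i'      ≤⟨ m≤m+n _ e' ⟩
    backSlot i' + e' ∎
    where open ≤-Reasoning

  back-< : ∀ {i i' : Fin m} {e e'} → toℕ i < toℕ i' → e' ≤ b i' →
           backSlot i' + e' < backSlot i + e
  back-< {i} {i'} {e} {e'} i<i' e'≤b = begin-strict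
    backSlot i' + e'  ≤⟨ +-monoʳ-≤ (backSlot i') e'≤b ⟩
    backSlot i' + b i' <⟨ backSlot-decreasing i<i' ⟩
    backSlot i        ≤⟨ m≤m+n _ e ⟩
    backSlot i + e    ∎
    where open ≤-Reasoning

  fronts-injective : ∀ {i i' : Fin m} {e e'} → e ≤ 1 → e' ≤ 1 →
                     2 * toℕ i + e ≡ 2 * toℕ i' + e' →
                     (i , frontKind (x i) e) ≡ (i' , frontKind (x i') e')
  fronts-injective {i} {i'} e≤1 e'≤1 eq with <-cmp (toℕ i) (toℕ i')
  ... | tri< i<i' _ _ = ⊥-elim (<-irrefl eq (<-≤-trans (front-< i<i' e≤1) (m≤m+n _ _)))
  ... | tri> _ _ i'<i = ⊥-elim (<-irrefl (sym eq) (<-≤-trans (front-< i'<i e'≤1) (m≤m+n _ _)))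
  ... | tri≈ _ i≡i' _ with toℕ-injective i≡i'
  ...   | refl with +-cancelˡ-≡ (2 * toℕ i) _ _ eq
  ...     | refl = refl

  backs-injective : ∀ {i i' : Fin m} {e e'} → e ≤ b i → e' ≤ b i' →
                    backSlot i + e ≡ backSlot i' + e' →
                    (i , backKind (x i) e) ≡ (i' , backKind (x i') e')
  backs-injective {i} {i'} e≤b e'≤b eq with <-cmp (toℕ i) (toℕ i')
  ... | tri< i<i' _ _ = ⊥-elim (<-irrefl (sym eq) (back-< i<i' e'≤b))
  ... | tri> _ _ i'<i = ⊥-elim (<-irrefl eq (back-< i'<i e≤b))
  ... | tri≈ _ i≡i' _ with toℕ-injective i≡i'
  ...   | refl with +-cancelˡ-≡ (backSlot i) _ _ eq
  ...     | refl = refl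

  placed-injective : ∀ {i i' K K' k} → Placed (x i) i K k → Placed (x i') i' K' k →
                     (i , K) ≡ (i' , K')
  placed-injective (front _ e≤1 refl refl) (front _ e'≤1 k≡ refl) = fronts-injective e≤1 e'≤1 k≡
  placed-injective {i} {i'} (front _ e≤1 refl _) (back _ _ k≡ _) =
    ⊥-elim (<-irrefl k≡ (front<back {i} {i'} e≤1))
  placed-injective {i} {i'} (back _ _ refl _) (front _ e'≤1 k≡ _) =
    ⊥-elim (<-irrefl (sym k≡) (front<back {i'} {i} e'≤1))
  placed-injective (back  _ e≤b refl refl) (back  _ e'≤b k≡ refl) = backs-injective e≤b e'≤b k≡

  placed-offset-mono : ∀ {i i' K K' k k'} → Placed (x i) i K k → Placed (x i') i' K' k' → k < k' →
                       offset (i , K) ≤ offset (i' , K')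
  placed-offset-mono {i} {i'} (front _ e≤1 refl refl) (front _ e'≤1 refl refl) k<k'
    rewrite offset-front (x i) i e≤1 | offset-front (x i') i' e'≤1 with <-cmp (toℕ i) (toℕ i')
  ... | tri< i<i' _ _ =
    ≤-trans (frontOffset≤ (x i) (toℕ i)) (≤-trans i<i' (≤frontOffset (x i') (toℕ i')))
  ... | tri> _ _ i'<i = ⊥-elim (<-asym k<k' (<-≤-trans (front-< i'<i e'≤1) (m≤m+n _ _)))
  ... | tri≈ _ i≡i' _ rewrite toℕ-injective i≡i' = ≤-refl
  placed-offset-mono {i} {i'} (front _ e≤1 refl refl) (back _ e'≤b refl refl) _
    rewrite offset-front (x i) i e≤1 | offset-back (x i') i' e'≤b =
    ≤-trans (frontOffset≤ (x i) (toℕ i)) (≤-trans (toℕ<n i) (m≤backOffset i'))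
  placed-offset-mono {i} {i'} (back _ _ refl _) (front _ e'≤1 refl _) k<k' =
    ⊥-elim (<-asym k<k' (front<back {i'} {i} e'≤1))
  placed-offset-mono {i} {i'} (back _ e≤b refl refl) (back _ e'≤b refl refl) k<k'
    rewrite offset-back (x i) i e≤b | offset-back (x i') i' e'≤b with toℕ i' ≤? toℕ i
  ... | yes i'≤i = backOffset-antitone i'≤i
  ... | no  i'≰i = ⊥-elim (<-asym k<k' (back-< (≰⇒> i'≰i) e'≤b))

  R-disjoint : ∀ (j j' : Job m) (s s' : ℕ) → j ≢ j' → R j ≡ just s → R j' ≡ just s' →
               (s + p ≤ s') ⊎ (s' + p ≤ s)
  R-disjoint (i , K) (i' , K') s s' j≢j' Rj≡ Rj'≡ with R-start (i , K) Rj≡ | R-start (i' , K') Rj'≡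
  ... | k , slot≡ , refl | k' , slot'≡ , refl
    with placed (x i) i K slot≡ | placed (x i') i' K' slot'≡ | <-cmp k k'
  ... | pl | pl' | tri< k<k' _ _ = inj₁ (separated k<k' (placed-offset-mono pl pl' k<k'))
  ... | pl | pl' | tri≈ _ refl _ = ⊥-elim (j≢j' (placed-injective pl pl'))
  ... | pl | pl' | tri> _ _ k'<k = inj₂ (separated k'<k (placed-offset-mono pl' pl k'<k))

  R-feasible : Feasible p rel dl R
  R-feasible = R-respects-windows , R-disjoint

  R-block-count : ∀ i r →
    let count = λ K → if is-just (R (i , K)) then 1 else 0 in
    count A + (count B + (count C + (count D + r))) ≡ (2 + suc (b i)) + r
  R-block-count i r with x i
  ... | false = refl
  ... | true  = refl

  scheduledCount-R : scheduledCount (allJobs m) R ≡ N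
  scheduledCount-R = begin
    sum (map count (cartesianProduct (allFin m) (A ∷ B ∷ C ∷ D ∷ [])))
      ≡⟨ count-blocks (allFin m) ⟩
    sum (map (λ i → 2 + suc (b i)) (allFin m))
      ≡⟨ sum-map-tabulate (λ i → 2 + suc (b i)) (λ i → i) ⟩
    sumFrom (λ i → 2 + suc (b i)) 0
      ≡⟨ sumFrom-+ (λ _ → 2) (λ i → suc (b i)) 0 ⟩
    sumFrom {m} (λ _ → 2) 0 + backCount 0
      ≡⟨ cong (_+ backCount 0) (sumFrom-const {m} 2) ⟩
    N ∎
    where
    open ≡-Reasoning
    count : Job m → ℕ
    count j = if is-just (R j) then 1 else 0
    count-blocks : ∀ is → sum (map count (cartesianProduct is (A ∷ B ∷ C ∷ D ∷ []))) ≡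
                          sum (map (λ i → 2 + suc (b i)) is)
    count-blocks []       = refl
    count-blocks (i ∷ is) = trans (R-block-count i _) (cong (2 + suc (b i) +_) (count-blocks is))

  releaseSlot-lower : ∀ i K → 2 * toℕ i ≤ releaseSlot (i , K)
  releaseSlot-lower i A = ≤-refl
  releaseSlot-lower i B = ≤-refl
  releaseSlot-lower i C = n≤1+n _
  releaseSlot-lower i D = n≤1+n _

  deadlineSlot-upper : ∀ i K → deadlineSlot (i , K) ≤ suc (backSlot i + b i)
  deadlineSlot-upper i K with x i
  deadlineSlot-upper i A | false = s≤s (m≤m+n _ 0)
  deadlineSlot-upper i B | false = m≤n⇒m≤1+n (m≤m+n _ 0)
  deadlineSlot-upper i C | false = m≤n⇒m≤1+n (≤-trans (frontSlots<backSlot i i) (m≤m+n _ 0))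
  deadlineSlot-upper i D | false = m≤n⇒m≤1+n (m≤m+n _ 0)
  deadlineSlot-upper i A | true  = s≤s (≤-reflexive (+-comm 1 (backSlot i)))
  deadlineSlot-upper i B | true  = s≤s (≤-reflexive (+-comm 1 (backSlot i)))
  deadlineSlot-upper i C | true  = m≤n⇒m≤1+n (≤-trans (frontSlots<backSlot i i) (m≤m+n _ 1))
  deadlineSlot-upper i D | true  = s≤s (m≤m+n _ 1)

  deadlineSlot-C : ∀ i → deadlineSlot (i , C) ≡ 2 + 2 * toℕ i
  deadlineSlot-C i with x i
  ... | false = refl
  ... | true  = refl

  dl-C : ∀ i → dl (i , C) ≡ u (toℕ i) + 2 * p
  dl-C i with x i
  ... | false = refl
  ... | true  = refl

  deadline<N+1 : ∀ j → dl j < suc N * p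
  deadline<N+1 (i , K) = begin-strict
    dl (i , K)                     <⟨ deadline<nextSlot (i , K) ⟩
    suc (deadlineSlot (i , K)) * p ≤⟨ *-monoˡ-≤ p (s≤s (≤-trans (deadlineSlot-upper i K) (backSlots<N i))) ⟩
    suc N * p                      ∎
    where open ≤-Reasoning

  early-kind : ∀ i K → releaseSlot (i , K) ≤ 2 * toℕ i + 0 → K ≡ A ⊎ K ≡ B
  early-kind i A _ = inj₁ refl
  early-kind i B _ = inj₂ refl
  early-kind i C r≤ = ⊥-elim (<-irrefl refl (≤-trans r≤ (≤-reflexive (+-identityʳ _))))
  early-kind i D r≤ = ⊥-elim (<-irrefl refl (≤-trans r≤ (≤-reflexive (+-identityʳ _))))

  late-not-C : ∀ i K {k} → backSlot i ≤ k → k < deadlineSlot (i , K) → K ≢ C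
  late-not-C i C P≤k k<d refl =
    <⇒≱ (<-≤-trans k<d (≤-reflexive (deadlineSlot-C i))) (≤-trans (frontSlots<backSlot i i) P≤k)

  late-kind-false : ∀ i K {k} → backSlot i ≤ k → k < deadlineSlotB false i K → K ≡ A
  late-kind-false i A _   _   = refl
  late-kind-false i B P≤k k<d = ⊥-elim (<⇒≱ k<d P≤k)
  late-kind-false i C P≤k k<d = ⊥-elim (<⇒≱ k<d (≤-trans (frontSlots<backSlot i i) P≤k))
  late-kind-false i D P≤k k<d = ⊥-elim (<⇒≱ k<d P≤k)

  late-kind-true : ∀ i K {k} → suc (backSlot i) ≤ k → k < deadlineSlotB true i K → K ≡ A ⊎ K ≡ B
  late-kind-true i A _   _   = inj₁ refl
  late-kind-true i B _   _   = inj₂ refl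
  late-kind-true i C P<k k<d =
    ⊥-elim (<⇒≱ k<d (≤-trans (frontSlots<backSlot i i) (≤-trans (n≤1+n _) P<k)))
  late-kind-true i D P<k k<d = ⊥-elim (<⇒≱ k<d P<k)

  unslotted : ∀ β i K → slotB β i K ≡ nothing → β ≡ false × K ≡ C
  unslotted false i A ()
  unslotted false i B ()
  unslotted false i C _ = refl , refl
  unslotted false i D ()
  unslotted true  i A ()
  unslotted true  i B ()
  unslotted true  i C ()
  unslotted true  i D ()

  back<N : ∀ i {e} → e ≤ b i → backSlot i + e < N
  back<N i e≤b = ≤-<-trans (+-monoʳ-≤ (backSlot i) e≤b) (backSlots<N i)

  front<N : ∀ i {e} → e ≤ 1 → 2 * toℕ i + e < N
  front<N i e≤1 = <-trans (front<back {i} {i} {e' = 0} e≤1) (back<N i z≤n)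

  placed<N : ∀ {i K k} → Placed (x i) i K k → k < N
  placed<N {i} (front _ e≤1 refl _) = front<N i e≤1
  placed<N {i} (back  _ e≤b refl _) = back<N i e≤b

  slot<N : ∀ {j k} → slot j ≡ just k → k < N
  slot<N {i , K} slot≡ = placed<N (placed (x i) i K slot≡)

  module Rigidity
    (job : ℕ → Job m)
    (job-injective : ∀ {k l} → k < N → l < N → job k ≡ job l → k ≡ l)
    (job-window : ∀ {k} → k < N → releaseSlot (job k) ≤ k × k < deadlineSlot (job k))
    (no-B-then-C : ∀ {k} i → suc k < N → job k ≡ (i , B) → job (suc k) ≡ (i , C) → ⊥)
    where

    window : ∀ {k j} → k < N → job k ≡ j → releaseSlot j ≤ k × k < deadlineSlot j
    window k<N refl = job-window k<N

    Settled : Fin m → Set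
    Settled i = ∀ {K k} → slot (i , K) ≡ just k → job k ≡ (i , K)

    settled-slot : ∀ {i K k} → Settled i → k < N → job k ≡ (i , K) → slot (i , K) ≡ just k
    settled-slot {i} {K} {k} settled k<N jk≡ with slot (i , K) in slot≡
    ... | just k' =
      cong just (job-injective (placed<N (placed (x i) i K slot≡)) k<N
                               (trans (settled slot≡) (sym jk≡)))
    ... | nothing with unslotted (x i) i K slot≡
    ...   | x≡false , refl =
      ⊥-elim (C≢D (cong proj₂ (trans (sym jk≡) (trans (cong job k≡) (settled D-slot)))))
      where
      C≢D : C ≢ D
      C≢D ()
      D-slot : slot (i , D) ≡ just (suc (2 * toℕ i))
      D-slot = cong (λ β → slotB β i D) x≡false
      k≡ : k ≡ suc (2 * toℕ i)
      k≡ with window k<N jk≡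
      ... | r≤k , k<d = ≤-antisym (s≤s⁻¹ (<-≤-trans k<d (≤-reflexive (deadlineSlot-C i)))) r≤k

    front-block : ∀ {i} → (∀ i' → toℕ i' < toℕ i → Settled i') → ∀ {e} → e ≤ 1 →
                  proj₁ (job (2 * toℕ i + e)) ≡ i
    front-block {i} earlier {e} e≤1 with job (2 * toℕ i + e) in jk≡
    ... | i' , K' with <-cmp (toℕ i') (toℕ i)
    ...   | tri≈ _ i'≡i _ = toℕ-injective i'≡i
    ...   | tri> _ _ i<i' =
      ⊥-elim (<⇒≱ (front-< {i} {i'} i<i' e≤1)
                  (≤-trans (releaseSlot-lower i' K') (proj₁ (window (front<N i e≤1) jk≡))))
    ...   | tri< i'<i _ _ with placed (x i') i' K' (settled-slot (earlier i' i'<i) (front<N i e≤1) jk≡)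
    ...     | front _ e'≤1 k≡ _ =
      ⊥-elim (<-irrefl (sym k≡) (<-≤-trans (front-< {i'} {i} i'<i e'≤1) (m≤m+n _ e)))
    ...     | back  _ _    k≡ _ = ⊥-elim (<-irrefl k≡ (front<back {i} {i'} e≤1))

    back-block : ∀ {i} → (∀ i' → toℕ i' < toℕ i → Settled i') → ∀ {e} → e ≤ b i →
                 proj₁ (job (backSlot i + e)) ≡ i
    back-block {i} earlier {e} e≤b with job (backSlot i + e) in jk≡
    ... | i' , K' with <-cmp (toℕ i') (toℕ i)
    ...   | tri≈ _ i'≡i _ = toℕ-injective i'≡i
    ...   | tri> _ _ i<i' = ⊥-elim (<⇒≱ (proj₂ (window (back<N i e≤b) jk≡)) (begin
      deadlineSlot (i' , K')   ≤⟨ deadlineSlot-upper i' K' ⟩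
      suc (backSlot i' + b i') ≤⟨ backSlot-decreasing i<i' ⟩
      backSlot i               ≤⟨ m≤m+n _ e ⟩
      backSlot i + e           ∎))
      where open ≤-Reasoning
    ...   | tri< i'<i _ _ with placed (x i') i' K' (settled-slot (earlier i' i'<i) (back<N i e≤b) jk≡)
    ...     | front _ e'≤1 k≡ _ = ⊥-elim (<-irrefl (sym k≡) (front<back {i'} {i} e'≤1))
    ...     | back  _ _    k≡ _ = ⊥-elim (<-irrefl k≡ (back-< i'<i e≤b))

    module Block (i : Fin m) (earlier : ∀ i' → toℕ i' < toℕ i → Settled i') where

      kind : ℕ → Kind
      kind k = proj₂ (job k)

      InBlock : ℕ → Set
      InBlock k = k < N × job k ≡ (i , kind k)

      front-in : ∀ {e} → e ≤ 1 → InBlock (2 * toℕ i + e)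
      front-in {e} e≤1 = front<N i e≤1 , cong (_, kind (2 * toℕ i + e)) (front-block earlier e≤1)

      back-in : ∀ {e} → e ≤ b i → InBlock (backSlot i + e)
      back-in {e} e≤b = back<N i e≤b , cong (_, kind (backSlot i + e)) (back-block earlier e≤b)

      front₀ : InBlock (2 * toℕ i + 0)
      front₀ = front-in z≤n

      front₁ : InBlock (2 * toℕ i + 1)
      front₁ = front-in ≤-refl

      back₀ : InBlock (backSlot i + 0)
      back₀ = back-in z≤n

      distinct : ∀ {k l} → InBlock k → InBlock l → k ≢ l → kind k ≢ kind l
      distinct (k<N , jk≡) (l<N , jl≡) k≢l same-kind =
        k≢l (job-injective k<N l<N (trans jk≡ (trans (cong (i ,_) same-kind) (sym jl≡))))

      fronts≢ : 2 * toℕ i + 0 ≢ 2 * toℕ i + 1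
      fronts≢ eq with +-cancelˡ-≡ (2 * toℕ i) 0 1 eq
      ... | ()

      backs≢ : backSlot i + 0 ≢ backSlot i + 1
      backs≢ eq with +-cancelˡ-≡ (backSlot i) 0 1 eq
      ... | ()

      front≢back : ∀ {e e'} → e ≤ 1 → 2 * toℕ i + e ≢ backSlot i + e'
      front≢back e≤1 = <⇒≢ (front<back {i} {i} e≤1)

      in-window : ∀ {k} → InBlock k → releaseSlot (i , kind k) ≤ k × k < deadlineSlot (i , kind k)
      in-window (k<N , jk≡) = window k<N jk≡

      first-early : kind (2 * toℕ i + 0) ≡ A ⊎ kind (2 * toℕ i + 0) ≡ B
      first-early = early-kind i _ (proj₁ (in-window front₀))

      no-BC : ¬ (kind (2 * toℕ i + 0) ≡ B × kind (2 * toℕ i + 1) ≡ C)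
      no-BC (≡B , ≡C) = no-B-then-C i (subst (_< N) (+-suc _ 0) (proj₁ front₁))
        (trans (proj₂ front₀) (cong (i ,_) ≡B))
        (subst (λ k → job k ≡ (i , C)) (+-suc _ 0) (trans (proj₂ front₁) (cong (i ,_) ≡C)))

      forced-false : x i ≡ false →
        kind (2 * toℕ i + 0) ≡ B × kind (2 * toℕ i + 1) ≡ D × kind (backSlot i + 0) ≡ A
      forced-false x≡false = Product.map₂ (_, back₀≡A) (kinds-false first-early back₀≡A
        (distinct front₀ front₁ fronts≢)
        (distinct front₀ back₀ (front≢back z≤n))
        (distinct back₀ front₁ (≢-sym (front≢back ≤-refl)))
        no-BC)
        where
        back₀≡A : kind (backSlot i + 0) ≡ A
        back₀≡A = late-kind-false i _ (m≤m+n _ 0)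
          (subst (λ β → backSlot i + 0 < deadlineSlotB β i (kind (backSlot i + 0))) x≡false
                 (proj₂ (in-window back₀)))

      forced-true : x i ≡ true →
        kind (2 * toℕ i + 0) ≡ A × kind (2 * toℕ i + 1) ≡ C ×
        kind (backSlot i + 0) ≡ D × kind (backSlot i + 1) ≡ B
      forced-true x≡true = kinds-true first-early back₁-late
        (late-not-C i _ (m≤m+n _ 0) (proj₂ (in-window back₀)))
        (distinct front₀ front₁ fronts≢)
        (distinct front₀ back₀ (front≢back z≤n))
        (distinct front₀ back₁ (front≢back z≤n))
        (distinct back₁ front₁ (≢-sym (front≢back ≤-refl)))
        (distinct back₁ back₀ (≢-sym backs≢))
        (distinct front₁ back₀ (front≢back ≤-refl))
        no-BC
        where
        back₁ : InBlock (backSlot i + 1)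
        back₁ = back-in (subst (λ β → 1 ≤ bit β) (sym x≡true) ≤-refl)
        back₁-late : kind (backSlot i + 1) ≡ A ⊎ kind (backSlot i + 1) ≡ B
        back₁-late = late-kind-true i _ (≤-reflexive (+-comm 1 (backSlot i)))
          (subst (λ β → backSlot i + 1 < deadlineSlotB β i (kind (backSlot i + 1))) x≡true
                 (proj₂ (in-window back₁)))

      front-kind : ∀ {e} → e ≤ 1 → kind (2 * toℕ i + e) ≡ frontKind (x i) e
      front-kind {e} e≤1 with x i in x≡
      front-kind {zero}        _        | false = proj₁ (forced-false x≡)
      front-kind {suc zero}    _        | false = proj₁ (proj₂ (forced-false x≡))
      front-kind {zero}        _        | true  = proj₁ (forced-true x≡)
      front-kind {suc zero}    _        | true  = proj₁ (proj₂ (forced-true x≡))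
      front-kind {suc (suc _)} (s≤s ()) | _

      back-kind : ∀ {e} → e ≤ b i → kind (backSlot i + e) ≡ backKind (x i) e
      back-kind {e} e≤b with x i in x≡
      back-kind {zero}        _        | false = proj₂ (proj₂ (forced-false x≡))
      back-kind {zero}        _        | true  = proj₁ (proj₂ (proj₂ (forced-true x≡)))
      back-kind {suc zero}    _        | true  = proj₂ (proj₂ (proj₂ (forced-true x≡)))
      back-kind {suc (suc _)} (s≤s ()) | true

    settle : ∀ i → (∀ i' → toℕ i' < toℕ i → Settled i') → Settled i
    settle i earlier {K} slot≡ with placed (x i) i K slot≡
    ... | front _ e≤1 refl refl = trans (proj₂ (front-in e≤1)) (cong (i ,_) (front-kind e≤1))
      where open Block i earlier
    ... | back  _ e≤b refl refl = trans (proj₂ (back-in e≤b)) (cong (i ,_) (back-kind e≤b))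
      where open Block i earlier

    settled-below : ∀ n {i} → toℕ i < n → Settled i
    settled-below (suc n) {i} i<1+n =
      settle i (λ i' i'<i → settled-below n (<-≤-trans i'<i (s≤s⁻¹ i<1+n)))

    job-at-slot : ∀ {j k} → slot j ≡ just k → job k ≡ j
    job-at-slot {i , K} = settled-below (suc (toℕ i)) ≤-refl

    slot-of-job : ∀ {j k} → k < N → job k ≡ j → slot j ≡ just k
    slot-of-job {i , K} = settled-slot (settled-below (suc (toℕ i)) ≤-refl)

  allJobs-unique : Unique (allJobs m)
  allJobs-unique = Unique.cartesianProduct⁺ (Unique.allFin⁺ m)
    (((λ ()) ∷ (λ ()) ∷ (λ ()) ∷ []) ∷ ((λ ()) ∷ (λ ()) ∷ []) ∷ ((λ ()) ∷ []) ∷ [] ∷ [])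

  allJobs-complete : ∀ j → j ∈ allJobs m
  allJobs-complete (i , K) = ∈-cartesianProduct⁺ (∈-allFin i) (kind∈ K)
    where
    kind∈ : ∀ K → K ∈ A ∷ B ∷ C ∷ D ∷ []
    kind∈ A = here refl
    kind∈ B = there (here refl)
    kind∈ C = there (there (here refl))
    kind∈ D = there (there (there (here refl)))

  open Sequencing {Job m} p 1≤p
    using (Enumeration; enumerate; start-<; job-injective; start-lower; fits-before; all-fit-before)
  open SlotAssignment slot N using (Realises)

  module Optimality (1≤m : 1 ≤ m) where

    module Analysis {S : Schedule (Job m)} (feasible : Feasible p rel dl S) where

      E : Enumeration S (scheduledCount (allJobs m) S)
      E = enumerate S (allJobs m) (fromℕ< 1≤m , A) allJobs-unique allJobs-complete (proj₂ feasible)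
      open Enumeration E

      n : ℕ
      n = scheduledCount (allJobs m) S

      respects-window : ∀ {k} → k < n → rel (job k) ≤ start k × start k + p ≤ dl (job k)
      respects-window {k} k<n = proj₁ feasible (job k) (start k) (job-start k<n)

      ends-before : ∀ {k} → k < n → start k + p < suc N * p
      ends-before {k} k<n = ≤-<-trans (proj₂ (respects-window k<n)) (deadline<N+1 (job k))

      scheduledCount≤N : n ≤ N
      scheduledCount≤N =
        s≤s⁻¹ (*-cancelʳ-< p n (suc N) (all-fit-before E (≤-trans 1≤p (m≤m+n p _)) ends-before))

      module Saturated (n≡N : n ≡ N) where

        <n : ∀ {k} → k < N → k < n
        <n = subst (_ <_) (sym n≡N)

        start<nextSlot : ∀ {k} → k < N → start k < suc k * p
        start<nextSlot {k} k<N = +-cancelʳ-< (suc d * p) (start k) (suc k * p) (begin-strict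
          start k + suc d * p   <⟨ fits-before E ends-before (trans 1+k+d≡N (sym n≡N)) ⟩
          suc N * p             ≡⟨ cong (_* p) (sym (trans (+-suc (suc k) d) (cong suc 1+k+d≡N))) ⟩
          (suc k + suc d) * p   ≡⟨ *-distribʳ-+ p (suc k) (suc d) ⟩
          suc k * p + suc d * p ∎)
          where
          open ≤-Reasoning hiding (start)
          d = N ∸ suc k
          1+k+d≡N : suc k + d ≡ N
          1+k+d≡N = m+[n∸m]≡n k<N

        job-window : ∀ {k} → k < N → releaseSlot (job k) ≤ k × k < deadlineSlot (job k)
        job-window {k} k<N = s≤s⁻¹ (*-cancelʳ-< p _ _ released) , s≤s⁻¹ (*-cancelʳ-< p _ _ due)
          where
          open ≤-Reasoning hiding (start)
          released : releaseSlot (job k) * p < suc k * p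
          released = begin-strict
            releaseSlot (job k) * p                         ≤⟨ m≤m+n _ _ ⟩
            releaseSlot (job k) * p + releaseOffset (job k) ≡⟨ sym (release-slots (job k)) ⟩
            rel (job k)                                     ≤⟨ proj₁ (respects-window (<n k<N)) ⟩
            start k                                         <⟨ start<nextSlot k<N ⟩
            suc k * p                                       ∎
          due : suc k * p < suc (deadlineSlot (job k)) * p
          due = begin-strict
            suc k * p                      ≡⟨ +-comm p (k * p) ⟩
            k * p + p                      ≤⟨ +-monoˡ-≤ p (start-lower E (<n k<N)) ⟩
            start k + p                    ≤⟨ proj₂ (respects-window (<n k<N)) ⟩
            dl (job k)                     <⟨ deadline<nextSlot (job k) ⟩
            suc (deadlineSlot (job k)) * p ∎

        B-then-C-too-late : ∀ {k} i → suc k < N → job k ≡ (i , B) → job (suc k) ≡ (i , C) → ⊥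
        B-then-C-too-late {k} i 1+k<N jk≡ j1+k≡ = <-irrefl refl (begin-strict
          u (toℕ i) + 2 * p     <⟨ ≤-reflexive (solve 2 (λ u p → con 1 :+ (u :+ con 2 :* p)
                                                              := u :+ con 1 :+ p :+ p) refl (u (toℕ i)) p) ⟩
          u (toℕ i) + 1 + p + p ≤⟨ +-monoˡ-≤ p (+-monoˡ-≤ p B-released) ⟩
          start k + p + p       ≤⟨ +-monoˡ-≤ p (start-gap (n<1+n k) (<n 1+k<N)) ⟩
          start (suc k) + p     ≤⟨ C-due ⟩
          dl (i , C)            ≡⟨ dl-C i ⟩
          u (toℕ i) + 2 * p     ∎)
          where
          open ≤-Reasoning hiding (start)
          B-released : rel (i , B) ≤ start k
          B-released = subst (λ j → rel j ≤ start k) jk≡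
                         (proj₁ (respects-window (<n (<-trans (n<1+n k) 1+k<N))))
          C-due : start (suc k) + p ≤ dl (i , C)
          C-due = subst (λ j → start (suc k) + p ≤ dl j) j1+k≡ (proj₂ (respects-window (<n 1+k<N)))

        open Rigidity job (λ k<N l<N → job-injective E (<n k<N) (<n l<N)) job-window B-then-C-too-late

        realises : Realises S
        realises = record
          { start    = start
          ; start-<  = λ k<l l<N → start-< E k<l (<n l<N)
          ; slotted  = λ slot≡ →
              trans (cong S (sym (job-at-slot slot≡))) (job-start (<n (slot<N slot≡)))
          ; slotted⁻ = slotted⁻
          }
          where
          slotted⁻ : ∀ {j s} → S j ≡ just s → ∃[ k ] slot j ≡ just k
          slotted⁻ Sj≡ with enumerates Sj≡
          ... | k , k<n , jk≡ = k , slot-of-job (subst (_ <_) n≡N k<n) jk≡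

    R-optimal : Optimal (allJobs m) p rel dl R
    R-optimal = R-feasible , λ S feasible →
      subst (_ ≤_) (sym scheduledCount-R) (Analysis.scheduledCount≤N feasible)

    optimal-realises : ∀ {S} → Optimal (allJobs m) p rel dl S → Realises S
    optimal-realises (feasible , maximal) = Analysis.Saturated.realises feasible
      (≤-antisym (Analysis.scheduledCount≤N feasible)
                 (subst (_≤ _) scheduledCount-R (maximal R R-feasible)))

lemma1 : (m p : ℕ) → 1 ≤ m → 2 * m + 3 ≤ p → (x : Fin m → Bool) →
    Optimal (allJobs m) p (Instance.rel m p x) (Instance.dl m p x) (Instance.R m p x)
    × (∀ (S : Schedule (Job m)) →
         Optimal (allJobs m) p (Instance.rel m p x) (Instance.dl m p x) S →
         SameJobsSameOrder S (Instance.R m p x))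
lemma1 m p 1≤m p-large x =
  R-optimal , λ S S-optimal →
    same-jobs-same-order slot<N (optimal-realises S-optimal) (optimal-realises R-optimal)
  where
  open Reduction m p x p-large
  open Optimality 1≤m
  open SlotAssignment slot N using (same-jobs-same-order)
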